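{- Let $G$ be an odd cactus and let $(V_B,V_W,E_B,E_W)$ be a black white partition of $G$. Then for any two distinct edges $u_1u_2,u_3u_4\in E_B$ and any strong rainbow coloring $c$ of $E(G)$, $c(u_1u_2)\neq c(u_3u_4)$.
   Context: All graphs are finite, simple, connected and non-empty. A cactus is a graph in which every edge lies in at most one cycle; an odd cactus is a cactus with no even cycle. A strong rainbow coloring of $E(G)$ is a map $c:E(G)\to\{1,\dots,k\}$ (not necessarily proper) such that every pair of vertices $u,v$ is joined by a shortest $u,v$ path whose edges have pairwise distinct colors. Antipodes: for an odd cycle $C$ and edge $v_2v_3\in E(C)$, the unique $v_1\in V(C)$ with $d(v_1,v_2)=d(v_1,v_3)$ is denoted $\mathrm{opp}(v_2v_3)$ (well defined in an odd cactus since each edge lies in at most one cycle). Black white partition: $(V_B,V_W,E_B,E_W)$ where $(V_B,V_W)$ is a partition of $V(G)$ and $(E_B,E_W)$ a partition of $E(G)$ such that: (1) for any cycle $C$ of $G$ and $e\in E(C)$, $e\in E_B$ iff $\mathrm{opp}(e)\in V_W$, and $e\in E_W$ iff $\mathrm{opp}(e)\in V_B$; (2) if $v_1v_2\in E_B$ then $\{v_1,v_2\}\subseteq V_B$; (3) if $v\in V_W$ then every edge $uv\in E(G)$ lies in $E_W$; (4) for every cut vertex $v\in V_W$ there is a component $K$ of $G-v$ with $E_B\subseteq E(K)$. -}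

module Defs where

open import Data.Nat using (ℕ; suc; _≤_; _%_)
open import Data.Fin using (Fin)
open import Data.Bool using (Bool; true; false)
open import Data.Maybe using (just)
open import Data.Product using (Σ; ∃; _×_; _,_)
open import Data.Sum using (_⊎_)
open import Data.List using (List; []; _∷_; _++_; take; length; head; last; map)
open import Data.List.Membership.Propositional using (_∈_; _∉_)
open import Data.List.Relation.Unary.Linked using (Linked)
open import Data.List.Relation.Unary.Unique.Propositional using (Unique)
open import Relation.Binary.PropositionalEquality using (_≡_; _≢_)
open import Relation.Nullary using (¬_)
open import Function.Bundles using (_⇔_)

record SimpleGraph (n : ℕ) : Set₁ where
  field
    Adj    : Fin n → Fin n → Set
    sym    : ∀ {u v} → Adj u v → Adj v u
    irrefl : ∀ {u} → ¬ Adj u u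

module _ {n : ℕ} (G : SimpleGraph n) where
  open SimpleGraph G

  V : Set
  V = Fin n

  edgesOf : List V → List (V × V)
  edgesOf []           = []
  edgesOf (x ∷ [])     = []
  edgesOf (x ∷ y ∷ xs) = (x , y) ∷ edgesOf (y ∷ xs)

  IsPath : V → V → List V → Set
  IsPath u v xs = Linked Adj xs × head xs ≡ just u × last xs ≡ just v × Unique xs

  -- length (number of edges) of a path xs is  length xs - 1; a shortest path
  -- has minimum length among all u,v paths
  IsShortestPath : V → V → List V → Set
  IsShortestPath u v xs = IsPath u v xs × (∀ ys → IsPath u v ys → length xs ≤ length ys)

  Dist : V → V → ℕ → Set
  Dist u v d = ∃ λ xs → IsShortestPath u v xs × length xs ≡ suc d

  Connected : Set
  Connected = ∀ u v → ∃ λ xs → IsPath u v xs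

  -- a cycle v₀ v₁ … v_{m-1} (m ≥ 3, distinct vertices, v_{m-1} v₀ adjacent)
  IsCycle : List V → Set
  IsCycle C = 3 ≤ length C × Unique C × Linked Adj (C ++ take 1 C)

  EdgeOn : V → V → List V → Set
  EdgeOn a b C = ((a , b) ∈ edgesOf (C ++ take 1 C)) ⊎ ((b , a) ∈ edgesOf (C ++ take 1 C))

  -- every edge lies in at most one cycle (two cycles through a common edge
  -- have the same edge set, i.e. are the same cycle)
  Cactus : Set
  Cactus = ∀ C C' → IsCycle C → IsCycle C' → ∀ a b → EdgeOn a b C → EdgeOn a b C' →
           ∀ p q → (EdgeOn p q C ⇔ EdgeOn p q C')

  OddCactus : Set
  OddCactus = Cactus × (∀ C → IsCycle C → length C % 2 ≡ 1)

  -- v₁ = opp(v₂v₃) on the cycle C: v₁ ∈ V(C) and d(v₁,v₂) = d(v₁,v₃)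
  IsOpp : List V → V → V → V → Set
  IsOpp C v₁ v₂ v₃ = v₁ ∈ C × ∃ λ d → Dist v₁ v₂ d × Dist v₁ v₃ d

  IsPathAvoiding : V → V → V → List V → Set
  IsPathAvoiding v a b xs = IsPath a b xs × v ∉ xs

  CutVertex : V → Set
  CutVertex v = ∃ λ a → ∃ λ b → a ≢ v × b ≢ v × ¬ (∃ λ xs → IsPathAvoiding v a b xs)

  InComponent : V → V → V → Set
  InComponent v w x = x ≢ v × ∃ λ xs → IsPathAvoiding v w x xs

  -- Black white partition (V_B, V_W, E_B, E_W): vertex x is in V_B iff
  -- black x ≡ true (else V_W); edge uv is in E_B iff eblack u v ≡ true (else E_W).
  record BlackWhitePartition : Set where
    field
      black  : V → Bool
      eblack : V → V → Bool
      eblack-sym : ∀ u v → Adj u v → eblack u v ≡ eblack v u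
      cond1  : ∀ C → IsCycle C → ∀ v₂ v₃ → EdgeOn v₂ v₃ C → ∀ v₁ → IsOpp C v₁ v₂ v₃ →
               (eblack v₂ v₃ ≡ true ⇔ black v₁ ≡ false) ×
               (eblack v₂ v₃ ≡ false ⇔ black v₁ ≡ true)
      cond2  : ∀ v₁ v₂ → Adj v₁ v₂ → eblack v₁ v₂ ≡ true →
               black v₁ ≡ true × black v₂ ≡ true
      cond3  : ∀ v → black v ≡ false → ∀ u → Adj u v → eblack u v ≡ false
      cond4  : ∀ v → CutVertex v → black v ≡ false →
               ∃ λ w → w ≢ v × (∀ x y → Adj x y → eblack x y ≡ true →
                                  InComponent v w x × InComponent v w y)

  -- strong rainbow coloring with colours Fin k; c u v is the colour of edge uv
  StrongRainbow : {k : ℕ} → (V → V → Fin k) → Set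
  StrongRainbow {k} c =
    (∀ u v → Adj u v → c u v ≡ c v u) ×
    (∀ u v → ∃ λ xs → IsShortestPath u v xs ×
                      Unique (map (λ e → c (Data.Product.proj₁ e) (Data.Product.proj₂ e)) (edgesOf xs)))

  DistinctEdges : V → V → V → V → Set
  DistinctEdges a b p q = ¬ ((a ≡ p × b ≡ q) ⊎ (a ≡ q × b ≡ p))

module Submission where

-- (1) In a graph all of whose cycles are odd, shortest paths are unique: two shortest
--     s–t paths that fork would meet again and close up an even cycle (geodesicsUnique).
-- (2) Key lemma (noEquidistant): an endpoint s of a black edge is never equidistant
--     from the ends a, b of a black edge. Otherwise the shortest paths from s to a and
--     to b fork at some w and, with ab, form a cycle in which w = opp(ab); so w is
--     white (condition 1), yet in a cactus w separates s from a (noBypass), which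
--     condition 4 forbids for a white vertex (whiteNonSeparating).
-- (3) For distinct black edges, (2) orients them as x x′ and y′ y facing each other;
--     then the unique, hence rainbow, geodesic from x to y starts with x x′ and ends
--     with y′ y, so the two colours differ (blackEdgesDiffer).

open import Data.Nat using (ℕ; zero; suc; _+_; _≤_; _<_; _%_; z≤n; s≤s)
open import Data.Nat.Properties
  using (+-comm; +-suc; ≤-trans; ≤-antisym; m≤n+m; m≤m+n; n≤1+n; ≤-pred; +-cancelˡ-≤; +-cancelʳ-≤;
         suc-injective; <-irrefl; <-cmp; ≤-<-trans; module ≤-Reasoning)
open import Data.Fin using (Fin; _≟_)
open import Data.Bool using (true; false)
open import Data.Maybe using (just)
open import Data.Maybe.Properties using (just-injective)
open import Data.Product using (∃; ∃₂; _×_; _,_; proj₁; proj₂)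
open import Data.Sum using (_⊎_; inj₁; inj₂)
open import Data.Empty using (⊥; ⊥-elim)
open import Data.List using (List; []; _∷_; _++_; length; head; last; map; drop; reverse)
open import Data.List.Properties
  using (++-assoc; length-++; length-reverse; reverse-involutive; reverse-++; unfold-reverse;
         ∷-injectiveˡ; ∷-injectiveʳ; ++-cancelˡ)
open import Data.List.Membership.Propositional using (_∈_; _∉_)
open import Data.List.Membership.Propositional.Properties using (∈-++⁺ˡ; ∈-++⁺ʳ; ∈-++⁻; ∈-∃++; ∈-map⁺)
open import Data.List.Relation.Unary.Any using (here; there)
open import Data.List.Relation.Unary.Any.Properties using (reverse⁻)
open import Data.List.Relation.Unary.All.Properties using (¬Any⇒All¬)
open import Data.List.Relation.Unary.AllPairs using ([]; _∷_)
open import Data.List.Relation.Unary.Linked using (Linked; []; [-]; _∷_)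
open import Data.List.Relation.Unary.Unique.Propositional using (Unique)
open import Data.List.Relation.Unary.Unique.Propositional.Properties using (Unique[x∷xs]⇒x∉xs)
import Data.List.Relation.Unary.Unique.Propositional.Properties as Unique
open import Data.List.Relation.Binary.Disjoint.Propositional using (Disjoint)
open import Data.List.Relation.Binary.Subset.Propositional using (_⊆_)
open import Relation.Binary.PropositionalEquality
open import Relation.Binary.Definitions using (DecidableEquality; tri<; tri≈; tri>)
open import Relation.Nullary using (¬_; yes; no)
open import Function.Bundles using (Equivalence)

open import Defs

double%2 : ∀ m → (m + m) % 2 ≡ 0
double%2 zero    = refl
double%2 (suc m) rewrite +-suc m m = double%2 m

Forked : {A : Set} → List A → List A → Set
Forked xs ys = ∀ {z} → head xs ≡ just z → head ys ≡ just z → ⊥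

module _ {A : Set} where

  head-++ : ∀ (xs : List A) {v ys zs} → head (xs ++ v ∷ ys) ≡ head (xs ++ v ∷ zs)
  head-++ []      = refl
  head-++ (_ ∷ _) = refl

  last-++ : ∀ (xs : List A) {v ys} → last (xs ++ v ∷ ys) ≡ last (v ∷ ys)
  last-++ []           = refl
  last-++ (_ ∷ [])     = refl
  last-++ (_ ∷ y ∷ xs) = last-++ (y ∷ xs)

  last⇒snoc : ∀ (xs : List A) {v} → last xs ≡ just v → ∃ λ ys → xs ≡ ys ++ v ∷ []
  last⇒snoc []           ()
  last⇒snoc (_ ∷ [])     refl = [] , refl
  last⇒snoc (x ∷ y ∷ xs) eq   with last⇒snoc (y ∷ xs) eq
  ... | ys , eq′ = x ∷ ys , cong (x ∷_) eq′

  snocView : ∀ (x : A) xs → ∃₂ λ ys y → x ∷ xs ≡ ys ++ y ∷ []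
  snocView x []       = [] , x , refl
  snocView x (y ∷ xs) with snocView y xs
  ... | ys , z , eq = x ∷ ys , z , cong (x ∷_) eq

  last-∈ : ∀ (xs : List A) {v} → last xs ≡ just v → v ∈ xs
  last-∈ xs eq with last⇒snoc xs eq
  ... | ys , refl = ∈-++⁺ʳ ys (here refl)

  length-snoc : ∀ (xs : List A) v → length (xs ++ v ∷ []) ≡ suc (length xs)
  length-snoc []       v = refl
  length-snoc (_ ∷ xs) v = cong suc (length-snoc xs v)

  length-mid : ∀ (xs : List A) {v} ys → length (xs ++ v ∷ ys) ≡ length (xs ++ v ∷ []) + length ys
  length-mid []       ys = refl
  length-mid (_ ∷ xs) ys = cong suc (length-mid xs ys)

  reverse-snoc : ∀ (xs : List A) v → reverse (xs ++ v ∷ []) ≡ v ∷ reverse xs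
  reverse-snoc xs v = reverse-++ xs (v ∷ [])

  last-reverse : ∀ (xs : List A) → last (reverse xs) ≡ head xs
  last-reverse []       = refl
  last-reverse (x ∷ xs) = trans (cong last (unfold-reverse x xs)) (last-++ (reverse xs))

  head-reverse : ∀ (xs : List A) → head (reverse xs) ≡ last xs
  head-reverse xs = trans (sym (last-reverse (reverse xs))) (cong last (reverse-involutive xs))

  length-cancelˡ : ∀ (pre : List A) {xs ys} → length (pre ++ xs) ≡ length (pre ++ ys) → length xs ≡ length ys
  length-cancelˡ []        eq = eq
  length-cancelˡ (_ ∷ pre) eq = length-cancelˡ pre (suc-injective eq)

  twoBranches : ∀ (X : List A) {x y} Y → X ++ x ∷ y ∷ reverse Y ≡ (X ++ x ∷ []) ++ reverse (Y ++ y ∷ [])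
  twoBranches X {x} {y} Y = trans (cong (λ L → X ++ x ∷ L) (sym (reverse-snoc Y y))) (sym (++-assoc X (x ∷ []) _))

  commonStart : ∀ (B B′ : List A) {u R R′} → B ++ u ∷ [] ≡ B′ ++ u ∷ [] → Forked (B ++ u ∷ R) (B′ ++ u ∷ R′) → ⊥
  commonStart []      B′ eq forked = forked refl (trans (head-++ B′) (cong head (sym eq)))
  commonStart (_ ∷ _) B′ eq forked = forked refl (trans (head-++ B′) (cong head (sym eq)))

  ∉-drop1 : ∀ {x} (xs : List A) → x ∉ xs → x ∉ drop 1 xs
  ∉-drop1 []       x∉ = x∉
  ∉-drop1 (_ ∷ xs) x∉ = λ m → x∉ (there m)

  Unique-∷ : ∀ {x} {xs : List A} → x ∉ xs → Unique xs → Unique (x ∷ xs)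
  Unique-∷ x∉xs u = ¬Any⇒All¬ _ x∉xs ∷ u

  Unique-++⁻ : ∀ (xs : List A) {ys} → Unique (xs ++ ys) → Unique xs × Unique ys × Disjoint xs ys
  Unique-++⁻ []       u = [] , u , λ ()
  Unique-++⁻ (x ∷ xs) u@(_ ∷ u′) with Unique-++⁻ xs u′
  ... | uxs , uys , disj = Unique-∷ (λ m → x∉ (∈-++⁺ˡ m)) uxs , uys , disj′
    where
    x∉ : x ∉ xs ++ _
    x∉ = Unique[x∷xs]⇒x∉xs u
    disj′ : Disjoint (x ∷ xs) _
    disj′ (here refl , m′) = x∉ (∈-++⁺ʳ xs m′)
    disj′ (there m   , m′) = disj (m , m′)

  Unique-reverse : ∀ {xs : List A} → Unique xs → Unique (reverse xs)
  Unique-reverse {[]}     u          = []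
  Unique-reverse {x ∷ xs} u@(_ ∷ u′) =
    subst Unique (sym (unfold-reverse x xs))
      (Unique.++⁺ (Unique-reverse u′) (Unique-∷ (λ ()) [])
        λ { (m , here refl) → Unique[x∷xs]⇒x∉xs u (reverse⁻ m) })

module _ {A : Set} {R : A → A → Set} where

  Linked-split : ∀ (xs : List A) {v ys} → Linked R (xs ++ v ∷ ys) → Linked R (xs ++ v ∷ []) × Linked R (v ∷ ys)
  Linked-split []           l       = [-] , l
  Linked-split (_ ∷ [])     (r ∷ l) = r ∷ [-] , l
  Linked-split (_ ∷ y ∷ xs) (r ∷ l) with Linked-split (y ∷ xs) l
  ... | l₁ , l₂ = r ∷ l₁ , l₂

  Linked-join : ∀ (xs : List A) {v ys} → Linked R (xs ++ v ∷ []) → Linked R (v ∷ ys) → Linked R (xs ++ v ∷ ys)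
  Linked-join []           _        l = l
  Linked-join (_ ∷ [])     (r ∷ _)  l = r ∷ l
  Linked-join (_ ∷ y ∷ xs) (r ∷ l₁) l = r ∷ Linked-join (y ∷ xs) l₁ l

  Linked-reverse : (∀ {x y} → R x y → R y x) → ∀ {xs} → Linked R xs → Linked R (reverse xs)
  Linked-reverse R-sym {[]}         []      = []
  Linked-reverse R-sym {_ ∷ []}     [-]     = [-]
  Linked-reverse R-sym {x ∷ y ∷ xs} (r ∷ l) =
    subst (Linked R) (sym reverse-xyxs)
      (Linked-join (reverse xs) (subst (Linked R) (unfold-reverse y xs) (Linked-reverse R-sym l)) (R-sym r ∷ [-]))
    where
    reverse-xyxs : reverse (x ∷ y ∷ xs) ≡ reverse xs ++ y ∷ x ∷ []
    reverse-xyxs = begin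
      reverse (x ∷ y ∷ xs)             ≡⟨ unfold-reverse x (y ∷ xs) ⟩
      reverse (y ∷ xs) ++ x ∷ []       ≡⟨ cong (_++ x ∷ []) (unfold-reverse y xs) ⟩
      (reverse xs ++ y ∷ []) ++ x ∷ [] ≡⟨ ++-assoc (reverse xs) (y ∷ []) (x ∷ []) ⟩
      reverse xs ++ y ∷ x ∷ []         ∎
      where open ≡-Reasoning

module _ {A : Set} (_≟ᴬ_ : DecidableEquality A) where
  open import Data.List.Membership.DecPropositional _≟ᴬ_ using (_∈?_)

  commonPrefix : ∀ x (xs ys : List A) → ∃ λ pre → ∃ λ w → ∃₂ λ xs′ ys′ →
                 x ∷ xs ≡ pre ++ w ∷ xs′ × x ∷ ys ≡ pre ++ w ∷ ys′ × Forked xs′ ys′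
  commonPrefix x []       ys       = [] , x , [] , ys , refl , refl , λ ()
  commonPrefix x (p ∷ xs) []       = [] , x , p ∷ xs , [] , refl , refl , λ _ ()
  commonPrefix x (p ∷ xs) (q ∷ ys) with p ≟ᴬ q
  ... | no p≢q   = [] , x , p ∷ xs , q ∷ ys , refl , refl ,
                   λ e₁ e₂ → p≢q (trans (just-injective e₁) (sym (just-injective e₂)))
  ... | yes refl with commonPrefix p xs ys
  ... | pre , w , xs′ , ys′ , e₁ , e₂ , f = x ∷ pre , w , xs′ , ys′ , cong (x ∷_) e₁ , cong (x ∷_) e₂ , f

  firstIn : ∀ (zs xs : List A) {a} → a ∈ xs → a ∈ zs →
            ∃ λ pre → ∃₂ λ v post → xs ≡ pre ++ v ∷ post × v ∈ zs × Disjoint pre zs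
  firstIn zs (x ∷ xs) a∈xs a∈zs with x ∈? zs
  ... | yes x∈zs = [] , x , xs , refl , x∈zs , λ ()
  ... | no  x∉zs with a∈xs
  ...   | here refl = ⊥-elim (x∉zs a∈zs)
  ...   | there a∈xs′ with firstIn zs xs a∈xs′ a∈zs
  ...     | pre , v , post , eq , v∈zs , disj = x ∷ pre , v , post , cong (x ∷_) eq , v∈zs , disj′
    where
    disj′ : Disjoint (x ∷ pre) zs
    disj′ (here refl , m) = x∉zs m
    disj′ (there p   , m) = disj (p , m)

module Paths {n : ℕ} (G : SimpleGraph n) where
  open SimpleGraph G renaming (sym to Adj-sym)
  open import Data.List.Membership.DecPropositional (_≟_ {n}) using (_∈?_)

  Vertex : Set
  Vertex = Fin n

  Walk : Vertex → Vertex → List Vertex → Set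
  Walk s t xs = Linked Adj xs × head xs ≡ just s × last xs ≡ just t

  path⇒walk : ∀ {s t P} → IsPath G s t P → Walk s t P
  path⇒walk (l , h , e , _) = l , h , e

  suffixPath : ∀ {s t} xs {v ys} → IsPath G s t (xs ++ v ∷ ys) → IsPath G v t (v ∷ ys)
  suffixPath xs (l , _ , e , u) =
    proj₂ (Linked-split xs l) , refl , trans (sym (last-++ xs)) e , proj₁ (proj₂ (Unique-++⁻ xs u))

  prefixPath : ∀ {s t} xs {v ys} → IsPath G s t (xs ++ v ∷ ys) → IsPath G s v (xs ++ v ∷ [])
  prefixPath xs (l , h , _ , u) with Unique-++⁻ xs u
  ... | uxs , _ , disj = proj₁ (Linked-split xs l) , trans (head-++ xs) h , last-++ xs ,
                         Unique.++⁺ uxs (Unique-∷ (λ ()) []) λ { (m , here refl) → disj (m , here refl) }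

  reversePath : ∀ {s t P} → IsPath G s t P → IsPath G t s (reverse P)
  reversePath {P = P} (l , h , e , u) =
    Linked-reverse Adj-sym l , trans (head-reverse P) e , trans (last-reverse P) h , Unique-reverse u

  eraseLoops : ∀ x xs {t} → Linked Adj (x ∷ xs) → last (x ∷ xs) ≡ just t →
               ∃ λ ys → IsPath G x t (x ∷ ys) × length ys ≤ length xs × x ∷ ys ⊆ x ∷ xs
  eraseLoops x []       l       e = [] , (l , refl , e , Unique-∷ (λ ()) []) , z≤n , λ m → m
  eraseLoops x (y ∷ xs) (r ∷ l) e with eraseLoops y xs l e
  ... | ys , p@(l′ , _ , e′ , u′) , le , sub with x ∈? y ∷ ys
  ...   | no x∉ = y ∷ ys , (r ∷ l′ , refl , e′ , Unique-∷ x∉ u′) , s≤s le ,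
                  λ { (here eq) → here eq ; (there m) → there (sub m) }
  ...   | yes x∈ with ∈-∃++ x∈
  ...     | pre , post , eq = post , suffixPath pre (subst (IsPath G y _) eq p) , post≤xs , sub′
    where
    post≤ys : suc (length post) ≤ suc (length ys)
    post≤ys = subst (suc (length post) ≤_) (trans (sym (length-++ pre)) (cong length (sym eq)))
                (m≤n+m (suc (length post)) (length pre))
    post≤xs : length post ≤ length (y ∷ xs)
    post≤xs = ≤-trans (≤-pred post≤ys) (≤-trans le (n≤1+n _))
    sub′ : x ∷ post ⊆ x ∷ y ∷ xs
    sub′ (here eq′) = here eq′
    sub′ (there m)  = there (sub (subst (_ ∈_) (sym eq) (∈-++⁺ʳ pre (there m))))

  walk⇒path : ∀ {s t} W → Walk s t W → ∃ λ P → IsPath G s t P × length P ≤ length W × P ⊆ W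
  walk⇒path []       (_ , () , _)
  walk⇒path (x ∷ xs) (l , refl , e) with eraseLoops x xs l e
  ... | ys , p , le , sub = x ∷ ys , p , s≤s le , sub

  joinWalks : ∀ {u v t} X Y → Walk u v X → Walk v t Y → Walk u t (X ++ drop 1 Y)
  joinWalks X []      _               (_ , () , _)
  joinWalks X (y ∷ Y) (lX , hX , eX) (lY , refl , eY) with last⇒snoc X eX
  ... | X₀ , refl = subst (Walk _ _) (sym (++-assoc X₀ (y ∷ []) Y))
                      (Linked-join X₀ lX lY , trans (head-++ X₀) hX , trans (last-++ X₀) eY)

  reverseAvoiding : ∀ {x u v P} → IsPathAvoiding G x u v P → IsPathAvoiding G x v u (reverse P)
  reverseAvoiding (p , x∉P) = reversePath p , λ m → x∉P (reverse⁻ m)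

  joinAvoiding : ∀ {x u v t X Y} → IsPathAvoiding G x u v X → IsPathAvoiding G x v t Y →
                 ∃ λ T → IsPathAvoiding G x u t T
  joinAvoiding {x} {X = X} {Y} (p , x∉X) (q , x∉Y)
    with walk⇒path (X ++ drop 1 Y) (joinWalks X Y (path⇒walk p) (path⇒walk q))
  ... | T , t , _ , sub = T , t , λ m → avoid (∈-++⁻ X (sub m))
    where
    avoid : x ∈ X ⊎ x ∈ drop 1 Y → ⊥
    avoid (inj₁ m) = x∉X m
    avoid (inj₂ m) = ∉-drop1 Y x∉Y m

  shortest≤walk : ∀ {s t P} W → IsShortestPath G s t P → Walk s t W → length P ≤ length W
  shortest≤walk W (_ , minimal) w with walk⇒path W w
  ... | Q , q , Q≤W , _ = ≤-trans (minimal Q q) Q≤W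

  shortestLengths : ∀ {s t P Q} → IsShortestPath G s t P → IsShortestPath G s t Q → length P ≡ length Q
  shortestLengths (p , minP) (q , minQ) = ≤-antisym (minP _ q) (minQ _ p)

  reverseShortest : ∀ {s t P} → IsShortestPath G s t P → IsShortestPath G t s (reverse P)
  reverseShortest {P = P} (p , minimal) = reversePath p , λ R r →
    subst₂ _≤_ (sym (length-reverse P)) (length-reverse R) (minimal (reverse R) (reversePath r))

  prefixShortest : ∀ {s t} xs {v ys} → IsShortestPath G s t (xs ++ v ∷ ys) → IsShortestPath G s v (xs ++ v ∷ [])
  prefixShortest xs {v} {ys} sp@(p , _) = prefixPath xs p , λ R r →
    +-cancelʳ-≤ (length ys) _ _ (begin
      length (xs ++ v ∷ []) + length ys ≡⟨ sym (length-mid xs ys) ⟩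
      length (xs ++ v ∷ ys)             ≤⟨ shortest≤walk (R ++ ys) sp
                                             (joinWalks R (v ∷ ys) (path⇒walk r) (path⇒walk (suffixPath xs p))) ⟩
      length (R ++ ys)                  ≡⟨ length-++ R ⟩
      length R + length ys              ∎)
    where open ≤-Reasoning

  suffixShortest : ∀ {s t} xs {v ys} → IsShortestPath G s t (xs ++ v ∷ ys) → IsShortestPath G v t (v ∷ ys)
  suffixShortest {s} {t} xs {v} {ys} sp@(p , _) = suffixPath xs p , bound
    where
    open ≤-Reasoning
    bound : ∀ R → IsPath G v t R → length (v ∷ ys) ≤ length R
    bound []      (_ , () , _)
    bound (r ∷ R) q = s≤s (+-cancelˡ-≤ (length (xs ++ v ∷ [])) _ _ (begin
      length (xs ++ v ∷ []) + length ys ≡⟨ sym (length-mid xs ys) ⟩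
      length (xs ++ v ∷ ys)             ≤⟨ shortest≤walk ((xs ++ v ∷ []) ++ R) sp
                                             (joinWalks (xs ++ v ∷ []) (r ∷ R) (path⇒walk (prefixPath xs p)) (path⇒walk q)) ⟩
      length ((xs ++ v ∷ []) ++ R)      ≡⟨ length-++ (xs ++ v ∷ []) ⟩
      length (xs ++ v ∷ []) + length R  ∎))

  neighbourBound : ∀ {s a b P Q} → Adj a b → IsShortestPath G s a P → IsShortestPath G s b Q →
                   length Q ≤ suc (length P)
  neighbourBound {b = b} {P} {Q} ab (p , _) spQ =
    subst (length Q ≤_) (length-snoc P b)
      (shortest≤walk (P ++ b ∷ []) spQ (joinWalks P (_ ∷ b ∷ []) (path⇒walk p) (ab ∷ [-] , refl , refl)))

  pathEndsOnce : ∀ {s v} xs {ys} → IsPath G s v (xs ++ v ∷ ys) → ys ≡ []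
  pathEndsOnce xs {[]}     _ = refl
  pathEndsOnce xs {y ∷ ys} p with suffixPath xs p
  ... | _ , _ , e , u = ⊥-elim (Unique[x∷xs]⇒x∉xs u (last-∈ (y ∷ ys) e))

  edge-mid : ∀ xs {a b ys} → (a , b) ∈ edgesOf G (xs ++ a ∷ b ∷ ys)
  edge-mid []           = here refl
  edge-mid (_ ∷ [])     = there (here refl)
  edge-mid (_ ∷ y ∷ xs) = there (edge-mid (y ∷ xs))

  edge-mem : ∀ xs {a b} → (a , b) ∈ edgesOf G xs → a ∈ xs × b ∈ xs
  edge-mem (x ∷ y ∷ xs) (here refl) = here refl , there (here refl)
  edge-mem (x ∷ y ∷ xs) (there m)   with edge-mem (y ∷ xs) m
  ... | a∈ , b∈ = there a∈ , there b∈

  forkCycle : ∀ {w x y} X Y → Adj x y →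
              Linked Adj (w ∷ X ++ x ∷ []) → Linked Adj (w ∷ Y ++ y ∷ []) →
              Unique (w ∷ X ++ x ∷ []) → Unique (w ∷ Y ++ y ∷ []) →
              Disjoint (X ++ x ∷ []) (Y ++ y ∷ []) →
              IsCycle G (w ∷ X ++ x ∷ y ∷ reverse Y)
  forkCycle {w} {x} {y} X Y xy lX lY uX@(_ ∷ uX′) uY@(_ ∷ uY′) disj = long , unique , closed
    where
    backBranch : reverse (w ∷ Y ++ y ∷ []) ≡ y ∷ reverse Y ++ w ∷ []
    backBranch = trans (reverse-snoc (w ∷ Y) y) (cong (y ∷_) (unfold-reverse w Y))
    long : 3 ≤ length (w ∷ X ++ x ∷ y ∷ reverse Y)
    long = s≤s (subst (2 ≤_) (sym (length-++ X)) (≤-trans (s≤s (s≤s z≤n)) (m≤n+m _ (length X))))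
    w∉ : w ∉ (X ++ x ∷ []) ++ reverse (Y ++ y ∷ [])
    w∉ m with ∈-++⁻ (X ++ x ∷ []) m
    ... | inj₁ m′ = Unique[x∷xs]⇒x∉xs uX m′
    ... | inj₂ m′ = Unique[x∷xs]⇒x∉xs uY (reverse⁻ m′)
    unique : Unique (w ∷ X ++ x ∷ y ∷ reverse Y)
    unique = subst (λ L → Unique (w ∷ L)) (sym (twoBranches X Y))
               (Unique-∷ w∉ (Unique.++⁺ uX′ (Unique-reverse uY′) λ (m , m′) → disj (m , reverse⁻ m′)))
    closed : Linked Adj ((w ∷ X ++ x ∷ y ∷ reverse Y) ++ w ∷ [])
    closed = subst (λ L → Linked Adj (w ∷ L)) (sym (++-assoc X (x ∷ y ∷ reverse Y) (w ∷ [])))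
               (Linked-join (w ∷ X) lX (xy ∷ subst (Linked Adj) backBranch (Linked-reverse Adj-sym lY)))

  forkMembers : ∀ {w x y v : Vertex} X Y → v ∈ w ∷ X ++ x ∷ y ∷ reverse Y → v ∈ w ∷ X ++ x ∷ [] ⊎ v ∈ Y ++ y ∷ []
  forkMembers         X Y (here eq) = inj₁ (here eq)
  forkMembers {x = x} X Y (there m) with ∈-++⁻ (X ++ x ∷ []) (subst (_ ∈_) (twoBranches X Y) m)
  ... | inj₁ m′ = inj₁ (there m′)
  ... | inj₂ m′ = inj₂ (reverse⁻ m′)

  throughBoth : ∀ {s t} A {w} Z {v Z′} → IsShortestPath G s t (A ++ w ∷ Z ++ v ∷ Z′) →
                IsPath G w v (w ∷ Z ++ v ∷ []) × IsShortestPath G s v (A ++ w ∷ Z ++ v ∷ [])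
  throughBoth {s} {t} A {w} Z {v} {Z′} sp =
    prefixPath (w ∷ Z) (suffixPath A (proj₁ sp)) ,
    subst (IsShortestPath G s v) (++-assoc A (w ∷ Z) (v ∷ []))
      (prefixShortest (A ++ w ∷ Z) (subst (IsShortestPath G s t) (sym (++-assoc A (w ∷ Z) (v ∷ Z′))) sp))

  predecessor : ∀ {s t w} A {rest} → IsPath G s t (A ++ w ∷ rest) → w ≢ s →
                ∃ λ z → Adj z w × IsPathAvoiding G w s z A
  predecessor []       (_ , refl , _) w≢s = ⊥-elim (w≢s refl)
  predecessor {s} {t} {w} (x ∷ A′) {rest} p w≢s with snocView x A′
  ... | A₀ , z , A≡ = z , zw , subst (IsPathAvoiding G w s z) (sym A≡) (prefixPath A₀ p′ , w∉A)
    where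
    p′ : IsPath G s t (A₀ ++ z ∷ w ∷ rest)
    p′ = subst (IsPath G s t) (trans (cong (_++ w ∷ rest) A≡) (++-assoc A₀ (z ∷ []) (w ∷ rest))) p
    zw : Adj z w
    zw = Data.List.Relation.Unary.Linked.head (proj₂ (Linked-split A₀ (proj₁ p′)))
    w∉A : w ∉ A₀ ++ z ∷ []
    w∉A m = proj₂ (proj₂ (Unique-++⁻ (x ∷ A′) (proj₂ (proj₂ (proj₂ p))))) (subst (w ∈_) (sym A≡) m , here refl)

  edgeAfter : ∀ {y w} X → ∃ λ y′ → ∀ xs → (y , y′) ∈ edgesOf G (xs ++ y ∷ X ++ w ∷ [])
  edgeAfter {w = w} []      = w , λ xs → edge-mid xs
  edgeAfter         (x ∷ _) = x , λ xs → edge-mid xs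

  detourCycle : ∀ {w z y} T₁ X₁ X₂ → IsCycle G (w ∷ X₁ ++ y ∷ X₂) → Adj z w →
                Linked Adj ((z ∷ T₁) ++ y ∷ []) → Unique (z ∷ T₁) → w ∉ z ∷ T₁ →
                Disjoint (z ∷ T₁) (X₁ ++ y ∷ X₂) → IsCycle G (w ∷ (z ∷ T₁) ++ y ∷ X₂)
  detourCycle {w} {z} {y} T₁ X₁ X₂ (_ , uC , lC) zw lT uT w∉T disj = long , unique , closed
    where
    long : 3 ≤ length (w ∷ (z ∷ T₁) ++ y ∷ X₂)
    long = s≤s (s≤s (subst (1 ≤_) (sym (length-++ T₁)) (≤-trans (s≤s z≤n) (m≤n+m _ (length T₁)))))
    w∉ : w ∉ (z ∷ T₁) ++ y ∷ X₂
    w∉ m with ∈-++⁻ (z ∷ T₁) m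
    ... | inj₁ m′ = w∉T m′
    ... | inj₂ m′ = Unique[x∷xs]⇒x∉xs uC (∈-++⁺ʳ X₁ m′)
    unique : Unique (w ∷ (z ∷ T₁) ++ y ∷ X₂)
    unique = Unique-∷ w∉ (Unique.++⁺ uT (proj₁ (proj₂ (Unique-++⁻ (w ∷ X₁) uC)))
                                     λ (m , m′) → disj (m , ∈-++⁺ʳ X₁ m′))
    alongCycle : Linked Adj (y ∷ X₂ ++ w ∷ [])
    alongCycle = proj₂ (Linked-split X₁ (subst (Linked Adj) (++-assoc X₁ (y ∷ X₂) (w ∷ []))
                                           (Data.List.Relation.Unary.Linked.tail lC)))
    closed : Linked Adj ((w ∷ (z ∷ T₁) ++ y ∷ X₂) ++ w ∷ [])
    closed = subst (λ L → Linked Adj (w ∷ L)) (sym (++-assoc (z ∷ T₁) (y ∷ X₂) (w ∷ [])))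
               (Adj-sym zw ∷ Linked-join (z ∷ T₁) lT alongCycle)

  -- In a cactus, a neighbour z of a cycle vertex w, lying off the cycle, cannot reach
  -- the rest of the cycle avoiding w: the detour cycle would share an edge with the
  -- first cycle, hence coincide with it, yet it contains the edge wz.
  noBypass : Cactus G → ∀ {w z a Ct T} → IsCycle G (w ∷ Ct) → Adj z w → z ∉ w ∷ Ct → a ∈ Ct →
             IsPathAvoiding G w z a T → ⊥
  noBypass cactus {w} {z} {a} {Ct} {T} isC zw z∉C a∈Ct ((lT , hT , eT , uT) , w∉T)
    with firstIn _≟_ Ct T (last-∈ T eT) a∈Ct
  ... | [] , y , _ , refl , y∈Ct , _ = z∉C (there (subst (_∈ Ct) (just-injective hT) y∈Ct))
  ... | t₁ ∷ T₁ , y , T₂ , refl , y∈Ct , T₁∩Ct=∅ with just-injective hT | ∈-∃++ y∈Ct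
  ... | refl | X₁ , X₂ , refl = offCycle (Equivalence.to (cactus D _ isD isC y y′ onD onC w z) (inj₁ (here refl)))
    where
    D : List Vertex
    D = w ∷ (z ∷ T₁) ++ y ∷ X₂
    isD : IsCycle G D
    isD = detourCycle T₁ X₁ X₂ isC zw (proj₁ (Linked-split (z ∷ T₁) lT)) (proj₁ (Unique-++⁻ (z ∷ T₁) uT))
            (λ m → w∉T (∈-++⁺ˡ m)) T₁∩Ct=∅
    y′ : Vertex
    y′ = proj₁ (edgeAfter {y} {w} X₂)
    onD : EdgeOn G y y′ D
    onD = inj₁ (subst (λ L → (y , y′) ∈ edgesOf G (w ∷ L)) (sym (++-assoc (z ∷ T₁) (y ∷ X₂) (w ∷ [])))
                 (proj₂ (edgeAfter X₂) (w ∷ z ∷ T₁)))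
    onC : EdgeOn G y y′ (w ∷ X₁ ++ y ∷ X₂)
    onC = inj₁ (subst (λ L → (y , y′) ∈ edgesOf G (w ∷ L)) (sym (++-assoc X₁ (y ∷ X₂) (w ∷ [])))
                 (proj₂ (edgeAfter X₂) (w ∷ X₁)))
    z∉closed : z ∉ (w ∷ X₁ ++ y ∷ X₂) ++ w ∷ []
    z∉closed m with ∈-++⁻ (w ∷ X₁ ++ y ∷ X₂) m
    ... | inj₁ m′        = z∉C m′
    ... | inj₂ (here eq) = irrefl (subst (λ v → Adj v w) eq zw)
    offCycle : EdgeOn G w z (w ∷ X₁ ++ y ∷ X₂) → ⊥
    offCycle (inj₁ m) = z∉closed (proj₂ (edge-mem _ m))
    offCycle (inj₂ m) = z∉closed (proj₁ (edge-mem _ m))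

  module OddCycles (odd : ∀ C → IsCycle G C → length C % 2 ≡ 1) where

    noEvenCycle : ∀ {m} C → IsCycle G C → length C ≢ m + m
    noEvenCycle {m} C isC even with trans (sym (odd C isC)) (trans (cong (_% 2) even) (double%2 m))
    ... | ()

    -- Two internally disjoint w–v paths of equal length would close up into an
    -- even cycle unless both are the single edge wv.
    equalForks : ∀ {w v} B B′ → IsPath G w v (w ∷ B ++ v ∷ []) → IsPath G w v (w ∷ B′ ++ v ∷ []) →
                 Disjoint B B′ → length B ≡ length B′ → B ≡ []
    equalForks []      _         _ _ _ _ = refl
    equalForks (_ ∷ _) []        _ _ _ ()
    equalForks {w} {v} (b ∷ B) (b′ ∷ B′) (lP , _ , _ , uP) (lQ , _ , _ , uQ) disj sameLength
      with snocView b′ B′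
    ... | Y , y , eqY = ⊥-elim (noEvenCycle {suc (length (b ∷ B))} C isCycle lengthC)
      where
      open ≡-Reasoning
      C : List Vertex
      C = w ∷ (b ∷ B) ++ v ∷ y ∷ reverse Y
      Q≡ : w ∷ (b′ ∷ B′) ++ v ∷ [] ≡ (w ∷ Y) ++ y ∷ v ∷ []
      Q≡ = cong (w ∷_) (trans (cong (_++ v ∷ []) eqY) (++-assoc Y (y ∷ []) (v ∷ [])))
      lY : Linked Adj (w ∷ Y ++ y ∷ []) × Linked Adj (y ∷ v ∷ [])
      lY = Linked-split (w ∷ Y) (subst (Linked Adj) Q≡ lQ)
      uY : Unique (w ∷ Y ++ y ∷ []) × Unique (v ∷ []) × Disjoint (w ∷ Y ++ y ∷ []) (v ∷ [])
      uY = Unique-++⁻ (w ∷ Y ++ y ∷ []) (subst Unique (trans Q≡ (sym (++-assoc (w ∷ Y) (y ∷ []) (v ∷ [])))) uQ)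
      v∉Y : v ∉ Y ++ y ∷ []
      v∉Y m = proj₂ (proj₂ uY) (there m , here refl)
      disj′ : Disjoint ((b ∷ B) ++ v ∷ []) (Y ++ y ∷ [])
      disj′ (m , m′) with ∈-++⁻ (b ∷ B) m
      ... | inj₁ m″        = disj (m″ , subst (_ ∈_) (sym eqY) m′)
      ... | inj₂ (here refl) = v∉Y m′
      isCycle : IsCycle G C
      isCycle = forkCycle (b ∷ B) Y (Adj-sym (Data.List.Relation.Unary.Linked.head (proj₂ lY)))
                  lP (proj₁ lY) uP (proj₁ uY) disj′
      lengthC : length C ≡ suc (length (b ∷ B)) + suc (length (b ∷ B))
      lengthC = cong suc (begin
        length ((b ∷ B) ++ v ∷ y ∷ reverse Y)           ≡⟨ length-++ (b ∷ B) ⟩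
        length (b ∷ B) + suc (suc (length (reverse Y))) ≡⟨ cong (λ k → length (b ∷ B) + suc (suc k)) (length-reverse Y) ⟩
        length (b ∷ B) + suc (suc (length Y))           ≡⟨ cong (λ k → length (b ∷ B) + suc k) |Y|+1 ⟩
        length (b ∷ B) + suc (length (b ∷ B))           ∎)
        where
        |Y|+1 : suc (length Y) ≡ length (b ∷ B)
        |Y|+1 = trans (sym (length-snoc Y y)) (trans (cong length (sym eqY)) (sym sameLength))

    -- Two shortest s–t paths that agree up to w and fork there cannot differ after w:
    -- at the first vertex v where they meet again, equalForks applies to the two
    -- w–v segments (which have equal length, both being shortest).
    forkedGeodesics : ∀ {s t} A w P Q → IsShortestPath G s t (A ++ w ∷ P) → IsShortestPath G s t (A ++ w ∷ Q) →
                      Forked P Q → P ≡ Q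
    forkedGeodesics A w [] [] _ _ _ = refl
    -- if one path stops at w, then w = t and the other cannot pass t and go on
    forkedGeodesics A w [] (_ ∷ _) ((_ , _ , e , _) , _) (q , _) _
      with just-injective (trans (sym (last-++ A)) e)
    ... | refl with pathEndsOnce A q
    ...   | ()
    forkedGeodesics A w (_ ∷ _) [] (p , _) ((_ , _ , e , _) , _) _
      with just-injective (trans (sym (last-++ A)) e)
    ... | refl with pathEndsOnce A p
    ...   | ()
    forkedGeodesics {s} {t} A w (p ∷ P) (q ∷ Q) spP@((_ , _ , eP , _) , _) spQ@((_ , _ , eQ , _) , _) forked
      with firstIn _≟_ (q ∷ Q) (p ∷ P) (last-∈ (p ∷ P) (trans (sym (last-++ A)) eP))
                                        (last-∈ (q ∷ Q) (trans (sym (last-++ A)) eQ))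
    ... | B , v , R , P≡ , v∈Q , B∩Q=∅ with ∈-∃++ v∈Q
    ... | B′ , R′ , Q≡ = ⊥-elim (forked (headIs B R P≡ B≡[]) (headIs B′ R′ Q≡ B′≡[]))
      where
      headIs : ∀ {x xs} Z Z′ → x ∷ xs ≡ Z ++ v ∷ Z′ → Z ≡ [] → head (x ∷ xs) ≡ just v
      headIs Z Z′ eq Z≡[] = trans (cong head eq) (cong (λ L → head (L ++ v ∷ Z′)) Z≡[])
      branchP : IsPath G w v (w ∷ B ++ v ∷ []) × IsShortestPath G s v (A ++ w ∷ B ++ v ∷ [])
      branchP = throughBoth A B (subst (λ L → IsShortestPath G s t (A ++ w ∷ L)) P≡ spP)
      branchQ : IsPath G w v (w ∷ B′ ++ v ∷ []) × IsShortestPath G s v (A ++ w ∷ B′ ++ v ∷ [])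
      branchQ = throughBoth A B′ (subst (λ L → IsShortestPath G s t (A ++ w ∷ L)) Q≡ spQ)
      sameLength : length B ≡ length B′
      sameLength = suc-injective (begin
        suc (length B)        ≡⟨ sym (length-snoc B v) ⟩
        length (B ++ v ∷ [])  ≡⟨ suc-injective (length-cancelˡ A (shortestLengths (proj₂ branchP) (proj₂ branchQ))) ⟩
        length (B′ ++ v ∷ []) ≡⟨ length-snoc B′ v ⟩
        suc (length B′)       ∎)
        where open ≡-Reasoning
      B∩B′=∅ : Disjoint B B′
      B∩B′=∅ (m , m′) = B∩Q=∅ (m , subst (_ ∈_) (sym Q≡) (∈-++⁺ˡ m′))
      B≡[] : B ≡ []
      B≡[] = equalForks B B′ (proj₁ branchP) (proj₁ branchQ) B∩B′=∅ sameLength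
      B′≡[] : B′ ≡ []
      B′≡[] = equalForks B′ B (proj₁ branchQ) (proj₁ branchP) (λ (m , m′) → B∩B′=∅ (m′ , m)) (sym sameLength)

    geodesicsUnique : ∀ {s t P Q} → IsShortestPath G s t P → IsShortestPath G s t Q → P ≡ Q
    geodesicsUnique {P = []}    ((_ , () , _) , _) _
    geodesicsUnique {Q = []}    _ ((_ , () , _) , _)
    geodesicsUnique {s} {t} {_ ∷ X} {_ ∷ Y} spP@((_ , refl , _) , _) spQ@((_ , refl , _) , _)
      with commonPrefix _≟_ s X Y
    ... | A , w , P′ , Q′ , P≡ , Q≡ , forked = begin
      s ∷ X         ≡⟨ P≡ ⟩
      A ++ w ∷ P′   ≡⟨ cong (λ L → A ++ w ∷ L)
                         (forkedGeodesics A w P′ Q′ (subst (IsShortestPath G s t) P≡ spP)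
                                                    (subst (IsShortestPath G s t) Q≡ spQ) forked) ⟩
      A ++ w ∷ Q′   ≡⟨ sym Q≡ ⟩
      s ∷ Y         ∎
      where open ≡-Reasoning


    -- Shortest paths from s that fork at w never meet again: a common vertex u
    -- would give two shortest s–u paths, equal by geodesicsUnique, so no fork at w.
    forkedDisjoint : ∀ {s a b} A w P Q → IsShortestPath G s a (A ++ w ∷ P) → IsShortestPath G s b (A ++ w ∷ Q) →
                     Forked P Q → Disjoint P Q
    forkedDisjoint {s} A w P Q spP spQ forked (u∈P , u∈Q) with ∈-∃++ u∈P | ∈-∃++ u∈Q
    ... | B , R , refl | B′ , R′ , refl = commonStart B B′ sameStart forked
      where
      sameStart : B ++ _ ∷ [] ≡ B′ ++ _ ∷ []
      sameStart = ∷-injectiveʳ (++-cancelˡ A _ _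
                    (geodesicsUnique (proj₂ (throughBoth A B spP)) (proj₂ (throughBoth A B′ spQ))))

    lastEdge : ∀ {s t t′ Q′ Q} → Adj t′ t → IsShortestPath G s t′ Q′ → IsShortestPath G s t Q →
               length Q′ < length Q → ∃ λ Q₀ → Q ≡ Q₀ ++ t′ ∷ t ∷ []
    lastEdge {s} {t} {t′} {Q′} {Q} t′t ((lQ′ , hQ′ , eQ′ , uQ′) , _) spQ@(_ , minimalQ) Q′<Q
      with last⇒snoc Q′ eQ′
    ... | Q₀ , refl = Q₀ , geodesicsUnique spQ extended
      where
      t∉Q′ : t ∉ Q₀ ++ t′ ∷ []
      t∉Q′ t∈ with ∈-∃++ t∈
      ... | X , Y , eq = <-irrefl refl (≤-<-trans Q≤Q′ Q′<Q)
        where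
        Q≤Q′ : length Q ≤ length (Q₀ ++ t′ ∷ [])
        Q≤Q′ = ≤-trans (minimalQ _ (prefixPath X (subst (IsPath G s t′) eq (lQ′ , hQ′ , eQ′ , uQ′))))
                 (subst (length (X ++ t ∷ []) ≤_) (trans (sym (length-mid X Y)) (cong length (sym eq)))
                   (m≤m+n _ (length Y)))
      extended : IsShortestPath G s t (Q₀ ++ t′ ∷ t ∷ [])
      extended =
        (Linked-join Q₀ lQ′ (t′t ∷ [-]) , trans (head-++ Q₀) hQ′ , last-++ Q₀ ,
         subst Unique (++-assoc Q₀ (t′ ∷ []) (t ∷ []))
           (Unique.++⁺ uQ′ (Unique-∷ (λ ()) []) λ { (m , here refl) → t∉Q′ m })) ,
        λ R r → ≤-trans (subst (_≤ length Q) (sym (trans (length-mid Q₀ (t ∷ [])) (+-comm _ 1))) Q′<Q)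
                        (minimalQ R r)

  module Partition (oddCactus : OddCactus G) (BW : BlackWhitePartition G) where
    open BlackWhitePartition BW
    open OddCycles (proj₂ oddCactus)

    BlackEnd : Vertex → Set
    BlackEnd x = ∃ λ x′ → Adj x x′ × eblack x x′ ≡ true

    blackEnd-black : ∀ {x} → BlackEnd x → black x ≡ true
    blackEnd-black (_ , xx′ , black-xx′) = proj₁ (cond2 _ _ xx′ black-xx′)

    blackEnd≢white : ∀ {x w} → BlackEnd x → black w ≡ false → x ≢ w
    blackEnd≢white x-black w-white refl with trans (sym (blackEnd-black x-black)) w-white
    ... | ()

    -- A white vertex separates no two endpoints of black edges: otherwise it would
    -- be a cut vertex, and condition (4) puts all black edges in one component of G − w.
    whiteNonSeparating : ∀ {w x y} → black w ≡ false → BlackEnd x → BlackEnd y →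
                         ¬ ¬ (∃ λ R → IsPathAvoiding G w x y R)
    whiteNonSeparating {w} {x} {y} w-white x-black@(x′ , xx′ , black-xx′) y-black@(y′ , yy′ , black-yy′) separated
      with cond4 w (x , y , blackEnd≢white x-black w-white , blackEnd≢white y-black w-white , separated) w-white
    ... | _ , _ , component =
      separated (joinAvoiding (reverseAvoiding (proj₂ (proj₂ (proj₁ (component x x′ xx′ black-xx′)))))
                              (proj₂ (proj₂ (proj₁ (component y y′ yy′ black-yy′)))))

    -- Shortest paths from s to a and to b agree up to w and
    -- then run disjointly; with the black edge ab they form a cycle C in which
    -- w = opp(ab), so w is white (condition 1) and in particular w ≠ s. In the
    -- cactus the predecessor of w towards s cannot reach a avoiding w (noBypass),
    -- so w separates s from a, contradicting whiteNonSeparating.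
    blackEdgeOnFork : ∀ {s a b} A w X Y → BlackEnd s → Adj a b → eblack a b ≡ true →
                      IsShortestPath G s a (A ++ w ∷ X ++ a ∷ []) →
                      IsShortestPath G s b (A ++ w ∷ Y ++ b ∷ []) →
                      Disjoint (X ++ a ∷ []) (Y ++ b ∷ []) → length X ≡ length Y → ⊥
    blackEdgeOnFork {s} {a} {b} A w X Y s-black ab black-ab spa@(pa , _) spb@(pb , _) disj sameLength =
      whiteNonSeparating w-white s-black (b , ab , black-ab) separated
      where
      C : List Vertex
      C = w ∷ X ++ a ∷ b ∷ reverse Y
      branchA : IsPath G w a (w ∷ X ++ a ∷ [])
      branchA = suffixPath A pa
      branchB : IsPath G w b (w ∷ Y ++ b ∷ [])
      branchB = suffixPath A pb
      isC : IsCycle G C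
      isC = forkCycle X Y ab (proj₁ branchA) (proj₁ branchB)
              (proj₂ (proj₂ (proj₂ branchA))) (proj₂ (proj₂ (proj₂ branchB))) disj
      abOnC : EdgeOn G a b C
      abOnC = inj₁ (subst (λ L → (a , b) ∈ edgesOf G (w ∷ L))
                      (sym (++-assoc X (a ∷ b ∷ reverse Y) (w ∷ []))) (edge-mid (w ∷ X)))
      w-opp : IsOpp G C w a b
      w-opp = here refl , length (X ++ a ∷ []) ,
              (_ , suffixShortest A spa , refl) ,
              (_ , suffixShortest A spb ,
               cong suc (trans (length-snoc Y b) (trans (cong suc (sym sameLength)) (sym (length-snoc X a)))))
      w-white : black w ≡ false
      w-white = Equivalence.to (proj₁ (cond1 C isC a b abOnC w w-opp)) black-ab
      A∩C=∅ : ∀ {v} → v ∈ A → v ∉ C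
      A∩C=∅ v∈A v∈C with forkMembers X Y v∈C
      ... | inj₁ m = proj₂ (proj₂ (Unique-++⁻ A (proj₂ (proj₂ (proj₂ pa))))) (v∈A , m)
      ... | inj₂ m = proj₂ (proj₂ (Unique-++⁻ A (proj₂ (proj₂ (proj₂ pb))))) (v∈A , there m)
      separated : ¬ (∃ λ R → IsPathAvoiding G w s a R)
      separated (_ , s⇝a) with predecessor A pa (λ w≡s → blackEnd≢white s-black w-white (sym w≡s))
      ... | z , zw , s⇝z@((_ , _ , eA , _) , _) =
        noBypass (proj₁ oddCactus) isC zw (A∩C=∅ (last-∈ A eA)) (∈-++⁺ʳ X (here refl))
          (proj₂ (joinAvoiding (reverseAvoiding s⇝z) s⇝a))

    -- Key lemma: an endpoint s of a black edge is never equidistant from the two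
    -- ends of a black edge ab. (Cut the shortest paths at their last common vertex
    -- w; if nothing follows w then a = w = b, otherwise blackEdgeOnFork applies.)
    noEquidistant : ∀ {s a b P Q} → BlackEnd s → Adj a b → eblack a b ≡ true →
                    IsShortestPath G s a P → IsShortestPath G s b Q → length P ≢ length Q
    noEquidistant {P = []} _ _ _ ((_ , () , _) , _) _
    noEquidistant {Q = []} _ _ _ _ ((_ , () , _) , _)
    noEquidistant {s} {a} {b} {_ ∷ X} {_ ∷ Y} s-black ab black-ab spa@((_ , refl , _) , _) spb@((_ , refl , _) , _)
                  sameLength with commonPrefix _≟_ s X Y
    ... | A , w , P′ , Q′ , P≡ , Q≡ , forked =
      afterFork P′ Q′ (subst (IsShortestPath G s a) P≡ spa) (subst (IsShortestPath G s b) Q≡ spb) forked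
        (length-cancelˡ A (trans (cong length (sym P≡)) (trans sameLength (cong length Q≡))))
      where
      afterFork : ∀ P′ Q′ → IsShortestPath G s a (A ++ w ∷ P′) → IsShortestPath G s b (A ++ w ∷ Q′) →
                  Forked P′ Q′ → length (w ∷ P′) ≡ length (w ∷ Q′) → ⊥
      afterFork []      []      ((_ , _ , ea , _) , _) ((_ , _ , eb , _) , _) _ _ =
        irrefl (subst (Adj a) (trans (sym (endsAt eb)) (endsAt ea)) ab)
        where
        endsAt : ∀ {t} → last (A ++ w ∷ []) ≡ just t → w ≡ t
        endsAt e = just-injective (trans (sym (last-++ A)) e)
      afterFork []      (_ ∷ _) _ _ _ ()
      afterFork (_ ∷ _) []      _ _ _ ()
      afterFork (p ∷ P) (q ∷ Q) spa′@((_ , _ , ea , _) , _) spb′@((_ , _ , eb , _) , _) forked′ sameLength′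
        with last⇒snoc (p ∷ P) (trans (sym (last-++ A)) ea) | last⇒snoc (q ∷ Q) (trans (sym (last-++ A)) eb)
      ... | X₀ , P≡X₀a | Y₀ , Q≡Y₀b =
        blackEdgeOnFork A w X₀ Y₀ s-black ab black-ab
          (subst (λ L → IsShortestPath G s a (A ++ w ∷ L)) P≡X₀a spa′)
          (subst (λ L → IsShortestPath G s b (A ++ w ∷ L)) Q≡Y₀b spb′)
          (subst₂ Disjoint P≡X₀a Q≡Y₀b (forkedDisjoint A w (p ∷ P) (q ∷ Q) spa′ spb′ forked′))
          (suc-injective (trans (sym (length-snoc X₀ a))
                           (trans (cong length (sym P≡X₀a)) (trans (suc-injective sameLength′)
                             (trans (cong length Q≡Y₀b) (length-snoc Y₀ b))))))

    module Rainbow {k : ℕ} (col : Vertex → Vertex → Fin k) (rainbow : StrongRainbow G col) where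

      edgeColour : Vertex × Vertex → Fin k
      edgeColour (u , v) = col u v

      geodesic : Vertex → Vertex → List Vertex
      geodesic u v = proj₁ (proj₂ rainbow u v)

      isGeodesic : ∀ u v → IsShortestPath G u v (geodesic u v)
      isGeodesic u v = proj₁ (proj₂ (proj₂ rainbow u v))

      rainbowColours : ∀ u v → Unique (map edgeColour (edgesOf G (geodesic u v)))
      rainbowColours u v = proj₂ (proj₂ (proj₂ rainbow u v))

      -- d u v is the distance from u to v plus one
      d : Vertex → Vertex → ℕ
      d u v = length (geodesic u v)

      d-reverse : ∀ u v → length (reverse (geodesic u v)) ≡ d v u
      d-reverse u v = shortestLengths (reverseShortest (isGeodesic u v)) (isGeodesic v u)

      d-sym : ∀ u v → d u v ≡ d v u
      d-sym u v = trans (sym (length-reverse (geodesic u v))) (d-reverse u v)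

      endEdgesDiffer : ∀ {x x′ y′ y} M Z → x ∷ x′ ∷ M ≡ Z ++ y′ ∷ y ∷ [] →
                       Unique (map edgeColour (edgesOf G (x ∷ x′ ∷ M))) →
                       ¬ (x ≡ y′ × x′ ≡ y) → col x x′ ≢ col y′ y
      endEdgesDiffer M []      eq _ distinct _ = distinct (∷-injectiveˡ eq , ∷-injectiveˡ (∷-injectiveʳ eq))
      endEdgesDiffer M (_ ∷ Z) eq unique _ same =
        Unique[x∷xs]⇒x∉xs unique
          (subst (_∈ map edgeColour (edgesOf G (_ ∷ M))) (sym same)
            (∈-map⁺ edgeColour (subst (λ L → (_ , _) ∈ edgesOf G L) (sym (∷-injectiveʳ eq)) (edge-mid Z))))

      -- Edges x x′ and y′ y "facing each other" (x′ nearer to y than x is, y′ nearer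
      -- to x than y is) are the first and last edges of the geodesic from x to y.
      facingEdges : ∀ {x x′ y′ y} → Adj x x′ → Adj y′ y → d y x′ < d y x → d x y′ < d x y →
                    ¬ (x ≡ y′ × x′ ≡ y) → col x x′ ≢ col y′ y
      facingEdges {x} {x′} {y′} {y} xx′ y′y x′-nearer y′-nearer distinct
        with lastEdge y′y (isGeodesic x y′) (isGeodesic x y) y′-nearer
           | lastEdge (Adj-sym xx′) (isGeodesic y x′) (reverseShortest (isGeodesic x y))
                      (subst (d y x′ <_) (sym (d-reverse x y)) x′-nearer)
      ... | Z , ends | R , reverseEnds =
        endEdgesDiffer (reverse R) Z (trans (sym starts) ends)
          (subst (λ L → Unique (map edgeColour (edgesOf G L))) starts (rainbowColours x y)) distinct
        where
        open ≡-Reasoning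
        starts : geodesic x y ≡ x ∷ x′ ∷ reverse R
        starts = begin
          geodesic x y                       ≡⟨ sym (reverse-involutive (geodesic x y)) ⟩
          reverse (reverse (geodesic x y))   ≡⟨ cong reverse reverseEnds ⟩
          reverse (R ++ x′ ∷ x ∷ [])         ≡⟨ reverse-++ R (x′ ∷ x ∷ []) ⟩
          x ∷ x′ ∷ reverse R                 ∎

      -- For distinct black edges ab and ce with b nearer to c than a is, the two
      -- colours differ: comparing the distances from a to c and to e (never equal
      -- by noEquidistant), one of the orientations of ce faces ab.
      nearerEnd : ∀ {a b c e} → Adj a b → eblack a b ≡ true → Adj c e → eblack c e ≡ true →
                  DistinctEdges G a b c e → d c b < d c a → col a b ≢ col c e
      nearerEnd {a} {b} {c} {e} ab black-ab ce black-ce distinct b-nearer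
        with <-cmp (d a c) (d a e)
      ... | tri≈ _ equal _ = ⊥-elim (noEquidistant (b , ab , black-ab) ce black-ce (isGeodesic a c) (isGeodesic a e) equal)
      ... | tri< c-nearer _ _ = facingEdges ab ce b-nearer′ c-nearer (λ (a≡c , b≡e) → distinct (inj₁ (a≡c , b≡e)))
        where
        open ≤-Reasoning
        b-nearer′ : d e b < d e a
        b-nearer′ = begin-strict
          d e b        ≡⟨ d-sym e b ⟩
          d b e        ≤⟨ neighbourBound ce (isGeodesic b c) (isGeodesic b e) ⟩
          suc (d b c)  ≡⟨ cong suc (d-sym b c) ⟩
          suc (d c b)  ≤⟨ b-nearer ⟩
          d c a        ≡⟨ d-sym c a ⟩
          d a c        <⟨ c-nearer ⟩
          d a e        ≡⟨ d-sym a e ⟩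
          d e a        ∎
      ... | tri> _ _ e-nearer =
        λ same → facingEdges ab (Adj-sym ce) b-nearer e-nearer (λ (a≡e , b≡c) → distinct (inj₂ (a≡e , b≡c)))
                   (trans same (proj₁ rainbow c e ce))

      blackEdgesDiffer : ∀ {a b c e} → Adj a b → Adj c e → eblack a b ≡ true → eblack c e ≡ true →
                         DistinctEdges G a b c e → col a b ≢ col c e
      blackEdgesDiffer {a} {b} {c} {e} ab ce black-ab black-ce distinct with <-cmp (d c a) (d c b)
      ... | tri≈ _ equal _ = ⊥-elim (noEquidistant (e , ce , black-ce) ab black-ab (isGeodesic c a) (isGeodesic c b) equal)
      ... | tri> _ _ b-nearer = nearerEnd ab black-ab ce black-ce distinct b-nearer
      ... | tri< a-nearer _ _ = λ same →
        nearerEnd (Adj-sym ab) (trans (sym (eblack-sym a b ab)) black-ab) ce black-ce swapped a-nearer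
          (trans (sym (proj₁ rainbow a b ab)) same)
        where
        swapped : DistinctEdges G b a c e
        swapped (inj₁ (b≡c , a≡e)) = distinct (inj₂ (a≡e , b≡c))
        swapped (inj₂ (b≡e , a≡c)) = distinct (inj₁ (a≡c , b≡e))

theorem1 : ∀ {n : ℕ} (G : SimpleGraph n) → 1 ≤ n → Connected G → OddCactus G →
    (P : BlackWhitePartition G) → ∀ {k : ℕ} (c : Fin n → Fin n → Fin k) →
    StrongRainbow G c →
    ∀ u₁ u₂ u₃ u₄ → SimpleGraph.Adj G u₁ u₂ → SimpleGraph.Adj G u₃ u₄ →
    BlackWhitePartition.eblack P u₁ u₂ ≡ true → BlackWhitePartition.eblack P u₃ u₄ ≡ true →
    DistinctEdges G u₁ u₂ u₃ u₄ → c u₁ u₂ ≢ c u₃ u₄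
theorem1 G _ _ oddCactus P c rainbow _ _ _ _ adj₁₂ adj₃₄ black₁₂ black₃₄ distinct =
  Paths.Partition.Rainbow.blackEdgesDiffer G oddCactus P c rainbow adj₁₂ adj₃₄ black₁₂ black₃₄ distinct
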